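{- For $n\ge 3$ let $G_n$ be the gear graph on $2n+1$ vertices. Then for every field $\mathbf F$, \[ wcdim(G_n,\mathbf F)=\begin{cases}3 & \text{if } n=3,\\ 0 & \text{if } n>3.\end{cases} \]
   Context: All graphs are finite, simple and undirected. An independent set of a graph $G$ is a set of pairwise non-adjacent vertices; it is maximal if it is not properly contained in another independent set. For a field $\mathbf F$, a well-covered weighting of $G$ is a function $w:V(G)\to\mathbf F$ such that $\sum_{x\in M}w(x)$ takes the same value for every maximal independent set $M$ of $G$. The well-covered weightings form an $\mathbf F$-vector space, whose dimension is denoted $wcdim(G,\mathbf F)$. The gear graph $G_n$ has vertex set $\{v_0,\dots,v_{2n-1},v_c\}$, where $v_i$ is adjacent to $v_{i-1 \bmod 2n}$ and $v_{i+1\bmod 2n}$ for $0\le i\le 2n-1$, and $v_i$ is adjacent to $v_c$ exactly when $i$ is even; there are no other edges. -}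

module Defs where

open import Level using (Level; _⊔_) renaming (suc to lsuc)
open import Data.Nat using (ℕ; zero; suc) renaming (_*_ to _*ℕ_; _<_ to _<ℕ_; _%_ to _%ℕ_)
open import Data.Fin using (Fin; toℕ) renaming (zero to fzero; suc to fsuc)
open import Data.Fin.Subset using (Subset; _∈_; _⊆_)
open import Data.Bool using (Bool; true; false)
open import Data.Vec using (lookup)
open import Data.Product using (_×_; ∃)
open import Data.Sum using (_⊎_)
open import Relation.Nullary using (¬_)
open import Relation.Binary.PropositionalEquality using (_≡_)
open import Algebra.Bundles using (CommutativeRing)

record Field (c ℓ : Level) : Set (lsuc (c ⊔ ℓ)) where
  field
    commutativeRing : CommutativeRing c ℓ
  open CommutativeRing commutativeRing public
  field
    1≉0     : ¬ (1# ≈ 0#)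
    inverse : ∀ x → ¬ (x ≈ 0#) → ∃ λ y → (x * y) ≈ 1#

-- Gear graph G_n on vertex set Fin (2n+1):
--   index i < 2n  is the rim vertex v_i,  index 2n is the centre v_c.

RimAdj : ℕ → ℕ → ℕ → Set
RimAdj n i j = (j ≡ suc i) ⊎ (i ≡ 0 × suc j ≡ 2 *ℕ n)

CentreAdj : ℕ → ℕ → ℕ → Set
CentreAdj n c j = c ≡ 2 *ℕ n × j <ℕ 2 *ℕ n × j %ℕ 2 ≡ 0

GearAdj : (n : ℕ) → Fin (suc (2 *ℕ n)) → Fin (suc (2 *ℕ n)) → Set
GearAdj n x y =
  (toℕ x <ℕ 2 *ℕ n × toℕ y <ℕ 2 *ℕ n × (RimAdj n (toℕ x) (toℕ y) ⊎ RimAdj n (toℕ y) (toℕ x)))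
  ⊎ CentreAdj n (toℕ x) (toℕ y)
  ⊎ CentreAdj n (toℕ y) (toℕ x)

module _ {N : ℕ} (Adj : Fin N → Fin N → Set) where

  Independent : Subset N → Set
  Independent S = ∀ x y → x ∈ S → y ∈ S → ¬ Adj x y

  MaximalIndependent : Subset N → Set
  MaximalIndependent S = Independent S × (∀ T → Independent T → S ⊆ T → T ⊆ S)

module _ {c ℓ : Level} (F : Field c ℓ) where
  open Field F

  Σ : (k : ℕ) → (Fin k → Carrier) → Carrier
  Σ zero    f = 0#
  Σ (suc k) f = f fzero + Σ k (λ i → f (fsuc i))

  weightOf : {N : ℕ} → Subset N → (Fin N → Carrier) → Carrier
  weightOf {N} S w = Σ N (λ x → sel (lookup S x) (w x))
    where
    sel : Bool → Carrier → Carrier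
    sel true  a = a
    sel false _ = 0#

  module _ {N : ℕ} (Adj : Fin N → Fin N → Set) where

    WellCovered : (Fin N → Carrier) → Set ℓ
    WellCovered w = ∀ M M' → MaximalIndependent Adj M → MaximalIndependent Adj M'
                      → weightOf M w ≈ weightOf M' w

    WcDim : ℕ → Set (c ⊔ ℓ)
    WcDim d = ∃ λ (b : Fin d → Fin N → Carrier) →
        (∀ i → WellCovered (b i))
      × (∀ (a : Fin d → Carrier) →
            (∀ x → Σ d (λ i → a i * b i x) ≈ 0#) → ∀ i → a i ≈ 0#)
      × (∀ w → WellCovered w →
            ∃ λ (a : Fin d → Carrier) → ∀ x → w x ≈ Σ d (λ i → a i * b i x))

module Submission where

-- Let E be the set of even rim vertices, C the odd rim vertices together with
-- the centre, and W k the set E with v₀, v₂, …, v_{2k} replaced by v₁, …, v_{2k-1}.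
-- All of them are maximal independent (checked through independence plus
-- domination).  W k and E agree beyond v_{2k}, so a well-covered weighting w
-- satisfies w(v₁) = w(v₀) + w(v₂) (k = 1), and for n ≥ 4 also
-- w(v₁) + w(v₃) = w(v₀) + w(v₂) + w(v₄) (k = 2).  Rotating the rim by two steps
-- is an automorphism, and automorphisms preserve well-coveredness, so these
-- relations hold around every even vertex.  For n ≥ 4 they make w vanish on the
-- rim, and comparing C with E then kills the centre.  For n = 3 the relations
-- express w through w(v₀), w(v₂), w(v₄); conversely, an exhaustive check over
-- all 2⁷ vertex sets shows that the three corresponding weightings are
-- well-covered.

open import Defs
open import Level using (Level)
open import Data.Nat using (ℕ; _≤_; _<_)
open import Data.Product using (_×_)
open import Relation.Binary.PropositionalEquality using (_≡_)

open import Function using (_∘_)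
open import Function.Bundles using (Equivalence)
open import Data.Nat using (zero; suc; z≤n; s≤s; z<s; s<s; _≡ᵇ_)
import Data.Nat as Nat
import Data.Nat.Properties as ℕₚ
open import Data.Nat.DivMod
  using (_%_; _/_; m%n<n; m<n⇒m%n≡m; [m+n]%n≡m%n; [m+kn]%n≡m%n; n%n≡0; %-distribˡ-+; m%n%n≡m%n;
         m∣n⇒o%n%m≡o%m; m≡m%n+[m/n]*n)
open import Data.Nat.Divisibility using (divides)
open import Data.Nat.Tactic.RingSolver using (solve-∀)
open import Data.Bool using (Bool; true; false; not; _∧_; if_then_else_; T)
open import Data.Bool.Properties using (not-involutive; not-¬; T-∧)
open import Data.Fin using (Fin; toℕ; fromℕ; fromℕ<; #_) renaming (zero to fzero; suc to fsuc)
open import Data.Fin.Properties using (any?; all?; toℕ<n; toℕ-fromℕ<; toℕ-fromℕ; toℕ-injective; suc-injective)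
open import Data.Fin.Subset using (Subset; _∈_; _∉_; _⊆_; _∪_; ⁅_⁆)
open import Data.Fin.Subset.Properties using (_∈?_; x∈⁅x⁆; x∈⁅y⁆⇒x≡y; x∈p∪q⁻; q⊆p∪q; p⊆p∪q)
open import Data.Fin.Permutation using (Permutation; permutation; _⟨$⟩ʳ_; _⟨$⟩ˡ_; inverseˡ; inverseʳ; flip)
open import Data.Vec using (Vec; []; _∷_; lookup; tabulate)
open import Data.Vec.Properties using (lookup∘tabulate; []=⇒lookup; lookup⇒[]=)
open import Data.Product using (_,_; ∃; proj₁; proj₂)
open import Data.Sum using (_⊎_; inj₁; inj₂)
open import Data.Empty using (⊥-elim)
open import Relation.Nullary using (¬_; Dec; yes; no; contradiction)
open import Relation.Nullary.Reflects using (ofʸ; ofⁿ)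
open import Relation.Nullary.Decidable using (⌊_⌋; fromWitness; _×-dec_; _⊎-dec_; _→-dec_; ¬?)
import Relation.Binary.PropositionalEquality as ≡
open ≡ using (_≢_; subst; subst₂)
import Algebra.Properties.CommutativeMonoid.Sum as MonoidSum

everyVec : ∀ {k} → (Vec Bool k → Bool) → Bool
everyVec {zero}  P = P []
everyVec {suc k} P = everyVec (P ∘ (true ∷_)) ∧ everyVec (P ∘ (false ∷_))

everyVec-sound : ∀ {k} (P : Vec Bool k → Bool) → T (everyVec P) → ∀ v → T (P v)
everyVec-sound {zero}  P h []          = h
everyVec-sound {suc k} P h (true ∷ v)  = everyVec-sound (P ∘ (true ∷_)) (proj₁ (Equivalence.to T-∧ h)) v
everyVec-sound {suc k} P h (false ∷ v) = everyVec-sound (P ∘ (false ∷_)) (proj₂ (Equivalence.to T-∧ h)) v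

module Graphs {N : ℕ} (Adj : Fin N → Fin N → Set) where

  Dominating : Subset N → Set
  Dominating S = ∀ x → x ∉ S → ∃ λ y → y ∈ S × (Adj x y ⊎ Adj y x)

  module _ (adj? : ∀ x y → Dec (Adj x y)) where
    independent? : ∀ S → Dec (Independent Adj S)
    independent? S = all? λ x → all? λ y → x ∈? S →-dec y ∈? S →-dec ¬? (adj? x y)

    dominating? : ∀ S → Dec (Dominating S)
    dominating? S = all? λ x → ¬? (x ∈? S) →-dec any? λ y → y ∈? S ×-dec (adj? x y ⊎-dec adj? y x)

  independent-dominating⇒maximal : ∀ S → Independent Adj S → Dominating S → MaximalIndependent Adj S
  independent-dominating⇒maximal S ind dom = ind , maximal
    where
    maximal : ∀ T → Independent Adj T → S ⊆ T → T ⊆ S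
    maximal T indT S⊆T {x} x∈T with x ∈? S
    ... | yes x∈S = x∈S
    ... | no x∉S with dom x x∉S
    ...   | y , y∈S , inj₁ xy = ⊥-elim (indT x y x∈T (S⊆T y∈S) xy)
    ...   | y , y∈S , inj₂ yx = ⊥-elim (indT y x (S⊆T y∈S) x∈T yx)

  -- Conversely, in a loopless graph with decidable adjacency a maximal
  -- independent set dominates, since a lonely vertex could be added to it.
  maximal⇒dominating : (∀ x → ¬ Adj x x) → (∀ x y → Dec (Adj x y)) →
                       ∀ S → MaximalIndependent Adj S → Dominating S
  maximal⇒dominating loopless adj? S (ind , maximal) x x∉S
    with any? (λ y → y ∈? S ×-dec (adj? x y ⊎-dec adj? y x))
  ... | yes neighbour = neighbour
  ... | no lonely = ⊥-elim (x∉S (maximal S+x ind+x (q⊆p∪q ⁅ x ⁆ S) (p⊆p∪q S (x∈⁅x⁆ x))))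
    where
    S+x : Subset N
    S+x = ⁅ x ⁆ ∪ S

    ind+x : Independent Adj S+x
    ind+x a b a∈ b∈ ab with x∈p∪q⁻ ⁅ x ⁆ S a∈ | x∈p∪q⁻ ⁅ x ⁆ S b∈
    ... | inj₁ a=x | inj₁ b=x = loopless x (subst₂ Adj (x∈⁅y⁆⇒x≡y x a=x) (x∈⁅y⁆⇒x≡y x b=x) ab)
    ... | inj₁ a=x | inj₂ b∈S = lonely (b , b∈S , inj₁ (subst (λ v → Adj v b) (x∈⁅y⁆⇒x≡y x a=x) ab))
    ... | inj₂ a∈S | inj₁ b=x = lonely (a , a∈S , inj₂ (subst (Adj a) (x∈⁅y⁆⇒x≡y x b=x) ab))
    ... | inj₂ a∈S | inj₂ b∈S = ind a b a∈S b∈S ab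

  pull : (Fin N → Fin N) → Subset N → Subset N
  pull σ S = tabulate (λ x → lookup S (σ x))

  pull⁺ : ∀ σ S {x} → σ x ∈ S → x ∈ pull σ S
  pull⁺ σ S {x} σx∈S = lookup⇒[]= x _ (≡.trans (lookup∘tabulate _ x) ([]=⇒lookup σx∈S))

  pull⁻ : ∀ σ S {x} → x ∈ pull σ S → σ x ∈ S
  pull⁻ σ S {x} x∈ = lookup⇒[]= (σ x) S (≡.trans (≡.sym (lookup∘tabulate _ x)) ([]=⇒lookup x∈))

  pull-independent : ∀ σ → (∀ {x y} → Adj x y → Adj (σ x) (σ y)) →
                     ∀ S → Independent Adj S → Independent Adj (pull σ S)
  pull-independent σ hom S ind x y x∈ y∈ xy = ind (σ x) (σ y) (pull⁻ σ S x∈) (pull⁻ σ S y∈) (hom xy)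

  record Automorphism : Set where
    field
      perm      : Permutation N N
      preserves : ∀ {x y} → Adj x y → Adj (perm ⟨$⟩ʳ x) (perm ⟨$⟩ʳ y)
      reflects  : ∀ {x y} → Adj (perm ⟨$⟩ʳ x) (perm ⟨$⟩ʳ y) → Adj x y

    apply : Fin N → Fin N
    apply = perm ⟨$⟩ʳ_

    unapply : Fin N → Fin N
    unapply = perm ⟨$⟩ˡ_

    unapply-preserves : ∀ {x y} → Adj x y → Adj (unapply x) (unapply y)
    unapply-preserves xy = reflects (subst₂ Adj (≡.sym (inverseʳ perm)) (≡.sym (inverseʳ perm)) xy)

    -- Pulling back along an automorphism keeps a set maximal independent: an
    -- independent T above the pull-back pulls back (along the inverse) to an
    -- independent set above S.
    pull-maximal : ∀ S → MaximalIndependent Adj S → MaximalIndependent Adj (pull apply S)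
    pull-maximal S (ind , maximal) = pull-independent apply preserves S ind , maximal′
      where
      maximal′ : ∀ T → Independent Adj T → pull apply S ⊆ T → T ⊆ pull apply S
      maximal′ T indT sub {y} y∈T =
        pull⁺ apply S (S⊇ (pull⁺ unapply T (subst (_∈ T) (≡.sym (inverseˡ perm)) y∈T)))
        where
        S⊇ : pull unapply T ⊆ S
        S⊇ = maximal (pull unapply T) (pull-independent unapply unapply-preserves T indT)
               (λ x∈S → pull⁺ unapply T (sub (pull⁺ apply S (subst (_∈ S) (≡.sym (inverseʳ perm)) x∈S))))

  invert : Automorphism → Automorphism
  invert σ = record
    { perm      = flip perm
    ; preserves = unapply-preserves
    ; reflects  = λ xy → subst₂ Adj (inverseʳ perm) (inverseʳ perm) (preserves xy)
    }
    where open Automorphism σ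

data Sign : Set where
  plus nought minus : Sign

isPlus : Sign → ℕ
isPlus plus = 1
isPlus _    = 0

isMinus : Sign → ℕ
isMinus minus = 1
isMinus _     = 0

pluses : ∀ {N} → Subset N → (Fin N → Sign) → ℕ
pluses []          s = 0
pluses (true ∷ S)  s = isPlus (s fzero) Nat.+ pluses S (s ∘ fsuc)
pluses (false ∷ S) s = pluses S (s ∘ fsuc)

minuses : ∀ {N} → Subset N → (Fin N → Sign) → ℕ
minuses []          s = 0
minuses (true ∷ S)  s = isMinus (s fzero) Nat.+ minuses S (s ∘ fsuc)
minuses (false ∷ S) s = minuses S (s ∘ fsuc)

module Weights {c ℓ : Level} (F : Field c ℓ) where
  open Field F
  open MonoidSum +-commutativeMonoid using (sum; sum-permute)
  open import Relation.Binary.Reasoning.Setoid setoid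
  open import Algebra.Definitions.RawMonoid +-rawMonoid using () renaming (_×_ to _·_)
  open import Algebra.Properties.CommutativeSemigroup +-commutativeSemigroup using (interchange)

  Σ-cong : ∀ k {f g : Fin k → Carrier} → (∀ x → f x ≈ g x) → Σ F k f ≈ Σ F k g
  Σ-cong zero    f≈g = refl
  Σ-cong (suc k) f≈g = +-cong (f≈g fzero) (Σ-cong k (f≈g ∘ fsuc))

  Σ-zero : ∀ k {f : Fin k → Carrier} → (∀ x → f x ≈ 0#) → Σ F k f ≈ 0#
  Σ-zero zero    f≈0 = refl
  Σ-zero (suc k) f≈0 = trans (+-cong (f≈0 fzero) (Σ-zero k (f≈0 ∘ fsuc))) (+-identityʳ 0#)

  Σ-single : ∀ k (f : Fin k → Carrier) c → (∀ x → x ≢ c → f x ≈ 0#) → Σ F k f ≈ f c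
  Σ-single (suc k) f fzero    f≈0 =
    trans (+-congˡ (Σ-zero k (λ x → f≈0 (fsuc x) λ ()))) (+-identityʳ (f fzero))
  Σ-single (suc k) f (fsuc c) f≈0 =
    trans (+-cong (f≈0 fzero λ ()) (Σ-single k (f ∘ fsuc) c (λ x x≢c → f≈0 (fsuc x) (x≢c ∘ suc-injective))))
          (+-identityˡ (f (fsuc c)))

  Σ≡sum : ∀ k (f : Fin k → Carrier) → Σ F k f ≡ sum f
  Σ≡sum zero    f = ≡.refl
  Σ≡sum (suc k) f = ≡.cong (f fzero +_) (Σ≡sum k (f ∘ fsuc))

  Σ-permute : ∀ k (f : Fin k → Carrier) (π : Permutation k k) → Σ F k f ≈ Σ F k (f ∘ (π ⟨$⟩ʳ_))
  Σ-permute k f π = begin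
    Σ F k f                ≡⟨ Σ≡sum k f ⟩
    sum f                  ≈⟨ sum-permute f π ⟩
    sum (f ∘ (π ⟨$⟩ʳ_))     ≡⟨ Σ≡sum k (f ∘ (π ⟨$⟩ʳ_)) ⟨
    Σ F k (f ∘ (π ⟨$⟩ʳ_))   ∎

  select : Bool → Carrier → Carrier
  select b a = if b then a else 0#

  weight-as-Σ : ∀ {N} (S : Subset N) w → weightOf F S w ≈ Σ F N (λ x → select (lookup S x) (w x))
  weight-as-Σ []          w = refl
  weight-as-Σ (true ∷ S)  w = +-congˡ (weight-as-Σ S (w ∘ fsuc))
  weight-as-Σ (false ∷ S) w = +-congˡ (weight-as-Σ S (w ∘ fsuc))

  weight-at : ∀ {N} (S : Subset N) w c → (∀ y → y ≢ c → w y ≈ 0#) → weightOf F S w ≈ select (lookup S c) (w c)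
  weight-at {N} S w c w≈0 = trans (weight-as-Σ S w) (Σ-single N _ c (λ y y≢c → select-0 (lookup S y) (w≈0 y y≢c)))
    where
    select-0 : ∀ b {a} → a ≈ 0# → select b a ≈ 0#
    select-0 true  a≈0 = a≈0
    select-0 false _   = refl

  ⟦_⟧ : Sign → Carrier
  ⟦ plus   ⟧ = 1#
  ⟦ nought ⟧ = 0#
  ⟦ minus  ⟧ = - 1#

  signed-weight : ∀ {N} (S : Subset N) (s : Fin N → Sign) →
                  weightOf F S (⟦_⟧ ∘ s) + minuses S s · 1# ≈ pluses S s · 1#
  signed-weight []          s = +-identityˡ 0#
  signed-weight (false ∷ S) s = trans (+-congʳ (+-identityˡ _)) (signed-weight S (s ∘ fsuc))
  signed-weight (true ∷ S)  s = step (s fzero) (signed-weight S (s ∘ fsuc))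
    where
    step : ∀ σ {W P Q} → W + Q · 1# ≈ P · 1# → (⟦ σ ⟧ + W) + (isMinus σ Nat.+ Q) · 1# ≈ (isPlus σ Nat.+ P) · 1#
    step plus   {W} {P} {Q} h = trans (+-assoc 1# W (Q · 1#)) (+-congˡ h)
    step nought {W} {P} {Q} h = trans (+-congʳ (+-identityˡ W)) h
    step minus  {W} {P} {Q} h = begin
      (- 1# + W) + (1# + Q · 1#)  ≈⟨ interchange (- 1#) W 1# (Q · 1#) ⟩
      (- 1# + 1#) + (W + Q · 1#)  ≈⟨ +-cong (-‿inverseˡ 1#) h ⟩
      0# + P · 1#                 ≈⟨ +-identityˡ _ ⟩
      P · 1#                      ∎

  module _ {N : ℕ} (Adj : Fin N → Fin N → Set) where
    open Graphs Adj

    weight-transport : ∀ (π : Permutation N N) S w →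
                       weightOf F S (w ∘ (π ⟨$⟩ʳ_)) ≈ weightOf F (pull (π ⟨$⟩ˡ_) S) w
    weight-transport π S w = begin
      weightOf F S (w ∘ (π ⟨$⟩ʳ_))
        ≈⟨ weight-as-Σ S _ ⟩
      Σ F N (λ x → select (lookup S x) (w (π ⟨$⟩ʳ x)))
        ≈⟨ Σ-permute N _ (flip π) ⟩
      Σ F N (λ y → select (lookup S (π ⟨$⟩ˡ y)) (w (π ⟨$⟩ʳ (π ⟨$⟩ˡ y))))
        ≈⟨ Σ-cong N (λ y → reflexive (≡.cong₂ select (≡.sym (lookup∘tabulate _ y)) (≡.cong w (inverseʳ π)))) ⟩
      Σ F N (λ y → select (lookup (pull (π ⟨$⟩ˡ_) S) y) (w y))
        ≈⟨ weight-as-Σ (pull (π ⟨$⟩ˡ_) S) w ⟨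
      weightOf F (pull (π ⟨$⟩ˡ_) S) w ∎

    well-covered-∘ : ∀ (σ : Automorphism) w → WellCovered F Adj w →
                     WellCovered F Adj (w ∘ Automorphism.apply σ)
    well-covered-∘ σ w wc M M′ mis mis′ = begin
      weightOf F M (w ∘ apply)               ≈⟨ weight-transport perm M w ⟩
      weightOf F (pull unapply M) w          ≈⟨ wc _ _ (carry M mis) (carry M′ mis′) ⟩
      weightOf F (pull unapply M′) w         ≈⟨ weight-transport perm M′ w ⟨
      weightOf F M′ (w ∘ apply)              ∎
      where
      open Automorphism σ
      carry : ∀ S → MaximalIndependent Adj S → MaximalIndependent Adj (pull unapply S)
      carry = Automorphism.pull-maximal (invert σ)

module Indices where
  open Nat using (_+_; _*_)
  open ℕₚ using (*-suc; ≤-pred; 1+n≢0)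
  open ≡ using (refl; sym; trans; cong)

  even? : ℕ → Bool
  even? zero    = true
  even? (suc i) = not (even? i)

  even?-+2 : ∀ i → even? (2 + i) ≡ even? i
  even?-+2 i = not-involutive (even? i)

  even?-double : ∀ k → even? (2 * k) ≡ true
  even?-double zero    = refl
  even?-double (suc k) = trans (cong even? (*-suc 2 k)) (trans (even?-+2 (2 * k)) (even?-double k))

  %2-parity : ∀ i → i % 2 ≡ (if even? i then 0 else 1)
  %2-parity zero          = refl
  %2-parity (suc zero)    = refl
  %2-parity (suc (suc i)) = trans (%2-parity i) (cong (λ b → if b then 0 else 1) (sym (even?-+2 i)))

  even?⇒%2 : ∀ i → even? i ≡ true → i % 2 ≡ 0
  even?⇒%2 i e = trans (%2-parity i) (cong (λ b → if b then 0 else 1) e)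

  %2⇒even? : ∀ i → i % 2 ≡ 0 → even? i ≡ true
  %2⇒even? i h with even? i | %2-parity i
  ... | true  | _ = refl
  ... | false | e = ⊥-elim (1+n≢0 (trans (sym e) h))

  -- rim? n i decides i < 2n; it is defined by recursion so that it computes
  -- on small numerals even when n is only known to be large.
  rim? : ℕ → ℕ → Bool
  rim? zero    _             = false
  rim? (suc n) zero          = true
  rim? (suc n) (suc zero)    = true
  rim? (suc n) (suc (suc i)) = rim? n i

  rim?⇒< : ∀ n i → rim? n i ≡ true → i < 2 * n
  rim?⇒< (suc n) zero          _ rewrite *-suc 2 n = z<s
  rim?⇒< (suc n) (suc zero)    _ rewrite *-suc 2 n = s<s z<s
  rim?⇒< (suc n) (suc (suc i)) h rewrite *-suc 2 n = s<s (s<s (rim?⇒< n i h))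

  <⇒rim? : ∀ n i → i < 2 * n → rim? n i ≡ true
  <⇒rim? zero    i             ()
  <⇒rim? (suc n) zero          _ = refl
  <⇒rim? (suc n) (suc zero)    _ = refl
  <⇒rim? (suc n) (suc (suc i)) h rewrite *-suc 2 n = <⇒rim? n i (≤-pred (≤-pred h))

  not≡false : ∀ {b} → not b ≡ false → b ≡ true
  not≡false {true} _ = refl

  not≡true : ∀ {b} → not b ≡ true → b ≡ false
  not≡true {false} _ = refl

  true≢false : ¬ (true ≡ false)
  true≢false ()

open Indices

module Gear (n : ℕ) where
  open Nat using (_+_; _*_; _≤ᵇ_; _≟_; _<?_)
  open ℕₚ
  open ≡ using (refl; sym; trans; cong)
  open Graphs (GearAdj n)

  RimEdge : ℕ → ℕ → Set
  RimEdge i j = RimAdj n i j ⊎ RimAdj n j i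

  swap-edge : ∀ {i j} → RimEdge i j → RimEdge j i
  swap-edge (inj₁ e) = inj₂ e
  swap-edge (inj₂ e) = inj₁ e

  -- adjacency on indices; GearAdj n x y is Adjℕ (toℕ x) (toℕ y) by definition
  Adjℕ : ℕ → ℕ → Set
  Adjℕ i j = (i < 2 * n × j < 2 * n × RimEdge i j) ⊎ CentreAdj n i j ⊎ CentreAdj n j i

  mask : (ℕ → Bool) → Subset (suc (2 * n))
  mask p = tabulate (p ∘ toℕ)

  Dominated : (ℕ → Bool) → ℕ → Set
  Dominated p i = ∃ λ j → j ≤ 2 * n × p j ≡ true × Adjℕ i j

  mask-maximal : ∀ p →
    (∀ i j → p i ≡ true → p j ≡ true → ¬ Adjℕ i j) →
    (∀ i → i ≤ 2 * n → p i ≡ false → Dominated p i) →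
    MaximalIndependent (GearAdj n) (mask p)
  mask-maximal p independent dominating =
    independent-dominating⇒maximal (mask p) independent′ dominating′
    where
    member : ∀ {x} → x ∈ mask p → p (toℕ x) ≡ true
    member {x} x∈ = trans (sym (lookup∘tabulate (p ∘ toℕ) x)) ([]=⇒lookup x∈)

    index : ∀ {j} → j ≤ 2 * n → Fin (suc (2 * n))
    index j≤ = fromℕ< (s≤s j≤)

    independent′ : Independent (GearAdj n) (mask p)
    independent′ x y x∈ y∈ = independent (toℕ x) (toℕ y) (member x∈) (member y∈)

    dominating′ : Dominating (mask p)
    dominating′ x x∉ with p (toℕ x) in px
    ... | true  = ⊥-elim (x∉ (lookup⇒[]= x (mask p) (trans (lookup∘tabulate (p ∘ toℕ) x) px)))
    ... | false with dominating (toℕ x) (≤-pred (toℕ<n x)) px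
    ...   | j , j≤ , pj , adj =
      index j≤ ,
      lookup⇒[]= (index j≤) (mask p)
        (trans (lookup∘tabulate (p ∘ toℕ) (index j≤)) (subst (λ k → p k ≡ true) (sym (toℕ-fromℕ< (s≤s j≤))) pj)) ,
      inj₁ (subst (Adjℕ (toℕ x)) (sym (toℕ-fromℕ< (s≤s j≤))) adj)

  -- neighbours on the rim have opposite parity, 2n being even
  rim-parity : ∀ {i j} → RimAdj n i j → even? j ≡ not (even? i)
  rim-parity (inj₁ refl)       = refl
  rim-parity (inj₂ (refl , e)) = not≡true (trans (cong even? e) (even?-double n))

  rim-edge-parity : ∀ {i j} → RimEdge i j → ¬ (even? i ≡ even? j)
  rim-edge-parity {i} (inj₁ ij) same = not-¬ refl (trans same (rim-parity ij))
  rim-edge-parity {i} {j} (inj₂ ji) same = not-¬ refl (trans (sym same) (rim-parity ji))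

  ¬centre<2n : ¬ (2 * n < 2 * n)
  ¬centre<2n = <-irrefl refl

  evens : ℕ → Bool
  evens i = even? i ∧ rim? n i

  evens⁻ : ∀ {i} → evens i ≡ true → even? i ≡ true × i < 2 * n
  evens⁻ {i} h with even? i | rim? n i in r
  ... | true | true = refl , rim?⇒< n i r

  evens⁺ : ∀ {i} → even? i ≡ true → i < 2 * n → evens i ≡ true
  evens⁺ {i} e i< rewrite e = <⇒rim? n i i<

  evens-odd : ∀ {i} → i < 2 * n → evens i ≡ false → even? i ≡ false
  evens-odd {i} i< h with even? i
  ... | false = refl
  ... | true  = ⊥-elim (true≢false (trans (sym (<⇒rim? n i i<)) h))

  evens-centre : evens (2 * n) ≡ false
  evens-centre with evens (2 * n) in h
  ... | true  = ⊥-elim (¬centre<2n (proj₂ (evens⁻ h)))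
  ... | false = refl

  centre-neighbour : ∀ {c j} → CentreAdj n c j → evens j ≡ true
  centre-neighbour {j = j} (_ , j< , j%2) = evens⁺ (%2⇒even? j j%2) j<

  evens-maximal : 1 ≤ n → MaximalIndependent (GearAdj n) (mask evens)
  evens-maximal 1≤n = mask-maximal evens independent dominating
    where
    0<2n : 0 < 2 * n
    0<2n = ≤-trans 1≤n (m≤m+n n (n + 0))

    independent : ∀ i j → evens i ≡ true → evens j ≡ true → ¬ Adjℕ i j
    independent i j ei ej (inj₁ (_ , _ , edge)) =
      rim-edge-parity edge (trans (proj₁ (evens⁻ ei)) (sym (proj₁ (evens⁻ ej))))
    independent i j ei ej (inj₂ (inj₁ (i≡ , _))) = <⇒≢ (proj₂ (evens⁻ ei)) i≡
    independent i j ei ej (inj₂ (inj₂ (j≡ , _))) = <⇒≢ (proj₂ (evens⁻ ej)) j≡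

    -- the centre is dominated by vertex 0, an odd rim vertex by its predecessor
    dominating : ∀ i → i ≤ 2 * n → evens i ≡ false → Dominated evens i
    dominating i i≤ ei with m≤n⇒m<n∨m≡n i≤
    ... | inj₂ refl = 0 , z≤n , evens⁺ refl 0<2n , inj₂ (inj₁ (refl , 0<2n , refl))
    ... | inj₁ i< = odd-dominated i i< (evens-odd i< ei)
      where
      odd-dominated : ∀ i → i < 2 * n → even? i ≡ false → Dominated evens i
      odd-dominated (suc j) i< odd =
        j , <⇒≤ j< , evens⁺ (not≡false odd) j< , inj₁ (i< , j< , inj₂ (inj₁ refl))
        where
        j< : j < 2 * n
        j< = <-trans (n<1+n j) i<

  odds+centre : ℕ → Bool
  odds+centre i = not (evens i)

  odds+centre-maximal : MaximalIndependent (GearAdj n) (mask odds+centre)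
  odds+centre-maximal = mask-maximal odds+centre independent dominating
    where
    independent : ∀ i j → odds+centre i ≡ true → odds+centre j ≡ true → ¬ Adjℕ i j
    independent i j ci cj (inj₁ (i< , j< , edge)) =
      rim-edge-parity edge (trans (evens-odd i< (not≡true ci)) (sym (evens-odd j< (not≡true cj))))
    independent i j ci cj (inj₂ (inj₁ c)) = true≢false (trans (sym (centre-neighbour c)) (not≡true cj))
    independent i j ci cj (inj₂ (inj₂ c)) = true≢false (trans (sym (centre-neighbour c)) (not≡true ci))

    dominating : ∀ i → i ≤ 2 * n → odds+centre i ≡ false → Dominated odds+centre i
    dominating i _ ci with evens⁻ (not≡false ci)
    ... | even , i< = 2 * n , ≤-refl , cong not evens-centre , inj₂ (inj₂ (refl , i< , even?⇒%2 i even))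

  window : ℕ → ℕ → Bool
  window k i = if i ≤ᵇ 2 * k then not (even? i) else evens i

  window-view : ∀ k i → (i ≤ 2 * k × window k i ≡ not (even? i)) ⊎ (2 * k < i × window k i ≡ evens i)
  window-view k i with i ≤ᵇ 2 * k | ≤ᵇ-reflects-≤ i (2 * k)
  ... | true  | ofʸ i≤ = inj₁ (i≤ , refl)
  ... | false | ofⁿ i≰ = inj₂ (≰⇒> i≰ , refl)

  module Window (k : ℕ) (1≤k : 1 ≤ k) (k+1<n : suc k < n) where
    room : 2 + 2 * k < 2 * n
    room = subst (_< 2 * n) (*-suc 2 k) (*-monoʳ-< 2 k+1<n)

    k<2n : 2 * k < 2 * n
    k<2n = ≤-trans (n≤1+n _) (≤-trans (n≤1+n _) room)

    inside⁺ : ∀ {i} → i ≤ 2 * k → even? i ≡ false → window k i ≡ true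
    inside⁺ {i} i≤ odd with window-view k i
    ... | inj₁ (_ , w) = trans w (cong not odd)
    ... | inj₂ (k< , _) = ⊥-elim (<⇒≱ k< i≤)

    outside⁺ : ∀ {i} → 2 * k < i → evens i ≡ true → window k i ≡ true
    outside⁺ {i} k< e with window-view k i
    ... | inj₁ (i≤ , _) = ⊥-elim (<⇒≱ k< i≤)
    ... | inj₂ (_ , w) = trans w e

    next : window k (2 + 2 * k) ≡ true
    next = outside⁺ (≤-trans (n<1+n (2 * k)) (n≤1+n _)) (evens⁺ (trans (even?-+2 (2 * k)) (even?-double k)) room)

    centre-outside : window k (2 * n) ≡ false
    centre-outside with window-view k (2 * n)
    ... | inj₁ (c≤ , _) = ⊥-elim (<⇒≱ (≤-trans (≤-trans (n≤1+n _) (n≤1+n _)) room) c≤)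
    ... | inj₂ (_ , w) = trans w evens-centre

    straddle : ∀ {i j} → i ≤ 2 * k → even? i ≡ false → 2 * k < j → ¬ RimEdge i j
    straddle i≤ odd k<j (inj₁ (inj₁ refl))       =
      true≢false (trans (sym (even?-double k)) (trans (cong even? (≤-antisym (≤-pred k<j) i≤)) odd))
    straddle i≤ odd k<j (inj₁ (inj₂ (refl , _))) = true≢false odd
    straddle i≤ odd k<j (inj₂ (inj₁ refl))       = <⇒≱ k<j (≤-trans (n≤1+n _) i≤)
    straddle i≤ odd ()  (inj₂ (inj₂ (refl , _)))

    rim-independent : ∀ {i j} → window k i ≡ true → window k j ≡ true → ¬ RimEdge i j
    rim-independent {i} {j} wi wj edge with window-view k i | window-view k j
    ... | inj₁ (_ , vi) | inj₁ (_ , vj) =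
      rim-edge-parity edge (trans (not≡true (trans (sym vi) wi)) (sym (not≡true (trans (sym vj) wj))))
    ... | inj₂ (_ , vi) | inj₂ (_ , vj) =
      rim-edge-parity edge (trans (proj₁ (evens⁻ (trans (sym vi) wi))) (sym (proj₁ (evens⁻ (trans (sym vj) wj)))))
    ... | inj₁ (i≤ , vi) | inj₂ (k<j , _) = straddle i≤ (not≡true (trans (sym vi) wi)) k<j edge
    ... | inj₂ (k<i , _) | inj₁ (j≤ , vj) = straddle j≤ (not≡true (trans (sym vj) wj)) k<i (swap-edge edge)

    independent : ∀ i j → window k i ≡ true → window k j ≡ true → ¬ Adjℕ i j
    independent i j wi wj (inj₁ (_ , _ , edge))    = rim-independent wi wj edge
    independent i j wi wj (inj₂ (inj₁ (refl , _))) = true≢false (trans (sym wi) centre-outside)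
    independent i j wi wj (inj₂ (inj₂ (refl , _))) = true≢false (trans (sym wj) centre-outside)

    inside-dominated : ∀ {i} → i < 2 * k → even? i ≡ true → Dominated (window k) i
    inside-dominated {i} i<k even = suc i , <⇒≤ (≤-<-trans i<k k<2n) , inside⁺ i<k (cong not even) ,
                                    inj₁ (<-trans i<k k<2n , ≤-<-trans i<k k<2n , inj₁ (inj₁ refl))

    last-dominated : ∀ i → i ≡ 2 * k → even? i ≡ true → Dominated (window k) i
    last-dominated zero    0≡k _    = ⊥-elim (<⇒≢ (≤-trans 1≤k (m≤m+n k (k + 0))) 0≡k)
    last-dominated (suc j) j<k even =
      j , ≤-trans (n≤1+n j) (<⇒≤ j<2n) , inside⁺ (≤-trans (n≤1+n j) (≤-reflexive j<k)) (not≡true even) ,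
      inj₁ (j<2n , <-trans (n<1+n j) j<2n , inj₂ (inj₁ refl))
      where
      j<2n : suc j < 2 * n
      j<2n = subst (_< 2 * n) (sym j<k) k<2n

    outside-dominated : ∀ i → 2 * k < i → i < 2 * n → even? i ≡ false → Dominated (window k) i
    outside-dominated (suc i) k<i i<n odd with m≤n⇒m<n∨m≡n (≤-pred k<i)
    ... | inj₁ k<i′ = i , <⇒≤ i′<n , outside⁺ k<i′ (evens⁺ (not≡false odd) i′<n) ,
                      inj₁ (i<n , i′<n , inj₂ (inj₁ refl))
      where
      i′<n : i < 2 * n
      i′<n = <-trans (n<1+n i) i<n
    ... | inj₂ refl = 2 + 2 * k , <⇒≤ room , next , inj₁ (i<n , room , inj₁ (inj₁ refl))

    centre-dominated : Dominated (window k) (2 * n)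
    centre-dominated = 2 + 2 * k , <⇒≤ room , next ,
                       inj₂ (inj₁ (refl , room , even?⇒%2 (2 + 2 * k) (trans (even?-+2 (2 * k)) (even?-double k))))

    dominating : ∀ i → i ≤ 2 * n → window k i ≡ false → Dominated (window k) i
    dominating i i≤ wi with window-view k i
    ... | inj₁ (i≤k , vi) with m≤n⇒m<n∨m≡n i≤k
    ...   | inj₁ i<k = inside-dominated i<k (not≡false (trans (sym vi) wi))
    ...   | inj₂ i≡k = last-dominated i i≡k (not≡false (trans (sym vi) wi))
    dominating i i≤ wi | inj₂ (k<i , vi) with m≤n⇒m<n∨m≡n i≤
    ...   | inj₁ i<n  = outside-dominated i k<i i<n (evens-odd i<n (trans (sym vi) wi))
    ...   | inj₂ refl = centre-dominated

    maximal : MaximalIndependent (GearAdj n) (mask (window k))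
    maximal = mask-maximal (window k) independent dominating

  window-maximal : ∀ k → 1 ≤ k → suc k < n → MaximalIndependent (GearAdj n) (mask (window k))
  window-maximal = Window.maximal

  -- the wrap-around edge joins two distinct vertices, since 2n ≠ 1
  wrap-loop : ∀ {i} → i ≡ 0 → ¬ (suc i ≡ 2 * n)
  wrap-loop refl e = true≢false (trans (sym (even?-double n)) (sym (cong even? e)))

  loopless : ∀ x → ¬ GearAdj n x x
  loopless x (inj₁ (_ , _ , inj₁ (inj₁ e)))       = 1+n≢n (sym e)
  loopless x (inj₁ (_ , _ , inj₁ (inj₂ (x≡0 , e)))) = wrap-loop x≡0 e
  loopless x (inj₁ (_ , _ , inj₂ (inj₁ e)))       = 1+n≢n (sym e)
  loopless x (inj₁ (_ , _ , inj₂ (inj₂ (x≡0 , e)))) = wrap-loop x≡0 e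
  loopless x (inj₂ (inj₁ (x≡ , x< , _)))          = <⇒≢ x< x≡
  loopless x (inj₂ (inj₂ (x≡ , x< , _)))          = <⇒≢ x< x≡


  adjacent? : ∀ x y → Dec (GearAdj n x y)
  adjacent? x y = (toℕ x <? 2 * n ×-dec toℕ y <? 2 * n ×-dec
                     (rim-adjacent? (toℕ x) (toℕ y) ⊎-dec rim-adjacent? (toℕ y) (toℕ x)))
                  ⊎-dec centre? (toℕ x) (toℕ y) ⊎-dec centre? (toℕ y) (toℕ x)
    where
    rim-adjacent? : ∀ i j → Dec (RimAdj n i j)
    rim-adjacent? i j = (j ≟ suc i) ⊎-dec ((i ≟ 0) ×-dec (suc j ≟ 2 * n))
    centre? : ∀ c j → Dec (CentreAdj n c j)
    centre? c j = (c ≟ 2 * n) ×-dec (j <? 2 * n) ×-dec (j % 2 ≟ 0)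

%-absorbˡ : ∀ m n d .{{_ : Nat.NonZero d}} → (m % d Nat.+ n) % d ≡ (m Nat.+ n) % d
%-absorbˡ m n d = begin
  (m % d + n) % d            ≡⟨ %-distribˡ-+ (m % d) n d ⟩
  (m % d % d + n % d) % d    ≡⟨ ≡.cong (λ r → (r + n % d) % d) (m%n%n≡m%n m d) ⟩
  (m % d + n % d) % d        ≡⟨ %-distribˡ-+ m n d ⟨
  (m + n) % d                ∎
  where
  open Nat using (_+_)
  open ≡.≡-Reasoning

-- Rotations of G_n, n = suc k: rotating the rim by an even number of steps
-- (and fixing the centre) is an automorphism.
module Rotation (k : ℕ) where
  open Nat using (_+_; _*_; _<ᵇ_)
  open ℕₚ
  open ≡ using (refl; sym; trans; cong; module ≡-Reasoning)
  open Gear (suc k)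
  open Graphs (GearAdj (suc k))

  N : ℕ
  N = 2 * suc k

  rot : ℕ → ℕ → ℕ
  rot a i = if i <ᵇ N then (i + 2 * a) % N else i

  rot-rim : ∀ a {i} → i < N → rot a i ≡ (i + 2 * a) % N
  rot-rim a {i} i< with i <ᵇ N | <ᵇ-reflects-< i N
  ... | true  | _      = refl
  ... | false | ofⁿ ¬< = contradiction i< ¬<

  rot-centre : ∀ a → rot a N ≡ N
  rot-centre a with N <ᵇ N | <ᵇ-reflects-< N N
  ... | true  | ofʸ N<N = contradiction N<N (<-irrefl refl)
  ... | false | _       = refl

  rot-rim< : ∀ a {i} → i < N → rot a i < N
  rot-rim< a {i} i< rewrite rot-rim a i< = m%n<n (i + 2 * a) N

  rot-bounded : ∀ a {i} → i ≤ N → rot a i ≤ N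
  rot-bounded a i≤ with m≤n⇒m<n∨m≡n i≤
  ... | inj₁ i<   = <⇒≤ (rot-rim< a i<)
  ... | inj₂ refl = ≤-reflexive (rot-centre a)

  rot-∘ : ∀ a b {i} → i ≤ N → rot a (rot b i) ≡ rot (b + a) i
  rot-∘ a b {i} i≤ with m≤n⇒m<n∨m≡n i≤
  ... | inj₂ refl = trans (cong (rot a) (rot-centre b)) (trans (rot-centre a) (sym (rot-centre (b + a))))
  ... | inj₁ i< = begin
    rot a (rot b i)                ≡⟨ rot-rim a (rot-rim< b i<) ⟩
    (rot b i + 2 * a) % N          ≡⟨ cong (λ r → (r + 2 * a) % N) (rot-rim b i<) ⟩
    ((i + 2 * b) % N + 2 * a) % N  ≡⟨ %-absorbˡ (i + 2 * b) (2 * a) N ⟩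
    (i + 2 * b + 2 * a) % N        ≡⟨ cong (_% N) (arith i a b) ⟩
    (i + 2 * (b + a)) % N          ≡⟨ rot-rim (b + a) i< ⟨
    rot (b + a) i                  ∎
    where
    open ≡-Reasoning
    arith : ∀ i a b → i + 2 * b + 2 * a ≡ i + 2 * (b + a)
    arith = solve-∀

  rot-turns : ∀ c {i} → i ≤ N → rot (c * suc k) i ≡ i
  rot-turns c {i} i≤ with m≤n⇒m<n∨m≡n i≤
  ... | inj₂ refl = rot-centre (c * suc k)
  ... | inj₁ i< = begin
    rot (c * suc k) i              ≡⟨ rot-rim (c * suc k) i< ⟩
    (i + 2 * (c * suc k)) % N      ≡⟨ cong (λ r → (i + r) % N) (arith c k) ⟩
    (i + c * N) % N                ≡⟨ [m+kn]%n≡m%n i c N ⟩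
    i % N                          ≡⟨ m<n⇒m%n≡m i< ⟩
    i                              ∎
    where
    open ≡-Reasoning
    arith : ∀ c k → 2 * (c * suc k) ≡ c * (2 * suc k)
    arith = solve-∀

  suc-% : ∀ m → suc m % N ≡ suc (m % N) % N
  suc-% m = trans (cong (_% N) (+-comm 1 m)) (trans (sym (%-absorbˡ m 1 N)) (cong (_% N) (+-comm (m % N) 1)))

  consecutive : ∀ m → RimEdge (m % N) (suc m % N)
  consecutive m with m≤n⇒m<n∨m≡n (m%n<n m N)
  ... | inj₁ r+1<N = inj₁ (inj₁ (trans (suc-% m) (m<n⇒m%n≡m r+1<N)))
  ... | inj₂ r+1≡N = inj₂ (inj₂ (trans (suc-% m) (trans (cong (_% N) r+1≡N) (n%n≡0 N)) , r+1≡N))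

  rot-edge : ∀ a {i j} → i < N → j < N → RimAdj (suc k) i j → RimEdge (rot a i) (rot a j)
  rot-edge a {i} i< j< (inj₁ refl) rewrite rot-rim a i< | rot-rim a j< = consecutive (i + 2 * a)
  rot-edge a {j = j} i< j< (inj₂ (refl , e)) rewrite rot-rim a i< | rot-rim a j< =
    swap-edge (subst (RimEdge ((j + 2 * a) % N)) wrap (consecutive (j + 2 * a)))
    where
    wrap : suc (j + 2 * a) % N ≡ (2 * a) % N
    wrap = trans (cong (λ m → (m + 2 * a) % N) e) (trans (cong (_% N) (+-comm N (2 * a))) ([m+n]%n≡m%n (2 * a) N))

  rot-centre-edge : ∀ a {c j} → CentreAdj (suc k) c j → CentreAdj (suc k) (rot a c) (rot a j)
  rot-centre-edge a {j = j} (refl , j< , j%2) = rot-centre a , rot-rim< a j< , parity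
    where
    open ≡-Reasoning
    parity : rot a j % 2 ≡ 0
    parity = begin
      rot a j % 2               ≡⟨ cong (_% 2) (rot-rim a j<) ⟩
      (j + 2 * a) % N % 2       ≡⟨ m∣n⇒o%n%m≡o%m 2 N (j + 2 * a) (divides (suc k) (*-comm 2 (suc k))) ⟩
      (j + 2 * a) % 2           ≡⟨ cong (λ r → (j + r) % 2) (*-comm 2 a) ⟩
      (j + a * 2) % 2           ≡⟨ [m+kn]%n≡m%n j a 2 ⟩
      j % 2                     ≡⟨ j%2 ⟩
      0                         ∎

  rot-adj : ∀ a {i j} → Adjℕ i j → Adjℕ (rot a i) (rot a j)
  rot-adj a (inj₁ (i< , j< , inj₁ e)) = inj₁ (rot-rim< a i< , rot-rim< a j< , rot-edge a i< j< e)
  rot-adj a (inj₁ (i< , j< , inj₂ e)) = inj₁ (rot-rim< a i< , rot-rim< a j< , swap-edge (rot-edge a j< i< e))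
  rot-adj a (inj₂ (inj₁ c))          = inj₂ (inj₁ (rot-centre-edge a c))
  rot-adj a (inj₂ (inj₂ c))          = inj₂ (inj₂ (rot-centre-edge a c))

  ρ : ℕ → Fin (suc N) → Fin (suc N)
  ρ a x = fromℕ< (s≤s (rot-bounded a (≤-pred (toℕ<n x))))

  toℕ-ρ : ∀ a x → toℕ (ρ a x) ≡ rot a (toℕ x)
  toℕ-ρ a x = toℕ-fromℕ< (s≤s (rot-bounded a (≤-pred (toℕ<n x))))

  ρ-adj : ∀ a {x y} → GearAdj (suc k) x y → GearAdj (suc k) (ρ a x) (ρ a y)
  ρ-adj a {x} {y} xy = subst₂ Adjℕ (sym (toℕ-ρ a x)) (sym (toℕ-ρ a y)) (rot-adj a xy)

  ρ-undo : ∀ a b c → b + a ≡ c * suc k → ∀ x → ρ a (ρ b x) ≡ x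
  ρ-undo a b c b+a x = toℕ-injective (begin
    toℕ (ρ a (ρ b x))        ≡⟨ toℕ-ρ a (ρ b x) ⟩
    rot a (toℕ (ρ b x))      ≡⟨ cong (rot a) (toℕ-ρ b x) ⟩
    rot a (rot b (toℕ x))    ≡⟨ rot-∘ a b x≤ ⟩
    rot (b + a) (toℕ x)      ≡⟨ cong (λ c → rot c (toℕ x)) b+a ⟩
    rot (c * suc k) (toℕ x)  ≡⟨ rot-turns c x≤ ⟩
    toℕ x                    ∎)
    where
    open ≡-Reasoning
    x≤ : toℕ x ≤ N
    x≤ = ≤-pred (toℕ<n x)

  rotation : ℕ → Automorphism
  rotation a = record
    { perm      = permutation (ρ a) (ρ (a * k)) (ρ-undo a (a * k) a (trans (+-comm (a * k) a) full))
                                                (ρ-undo (a * k) a a full)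
    ; preserves = ρ-adj a
    ; reflects  = λ {x} {y} xy → subst₂ (GearAdj (suc k)) (ρ-undo (a * k) a a full x)
                                        (ρ-undo (a * k) a a full y) (ρ-adj (a * k) xy)
    }
    where
    full : a + a * k ≡ a * suc k
    full = sym (*-suc a k)

  rot-2 : 2 < N → rot k 2 ≡ 0
  rot-2 2<N = begin
    rot k 2          ≡⟨ rot-rim k 2<N ⟩
    (2 + 2 * k) % N  ≡⟨ cong (_% N) (*-suc 2 k) ⟨
    N % N            ≡⟨ n%n≡0 N ⟩
    0                ∎
    where open ≡-Reasoning

  ρ-shift : ∀ a x → toℕ x + 2 * a < N → toℕ (ρ a x) ≡ toℕ x + 2 * a
  ρ-shift a x lt = trans (toℕ-ρ a x) (trans (rot-rim a (≤-<-trans (m≤m+n (toℕ x) (2 * a)) lt)) (m<n⇒m%n≡m lt))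

  orbit : ∀ x → toℕ x < N → ∃ λ a → ∃ λ b → toℕ b < 2 × ρ a b ≡ x
  orbit x x< = toℕ x / 2 , b , b<2 , toℕ-injective (begin
    toℕ (ρ (toℕ x / 2) b)               ≡⟨ toℕ-ρ (toℕ x / 2) b ⟩
    rot (toℕ x / 2) (toℕ b)             ≡⟨ cong (rot (toℕ x / 2)) (toℕ-fromℕ< b<) ⟩
    rot (toℕ x / 2) (toℕ x % 2)         ≡⟨ rot-rim (toℕ x / 2) (<-≤-trans (m%n<n (toℕ x) 2) 2≤N) ⟩
    (toℕ x % 2 + 2 * (toℕ x / 2)) % N   ≡⟨ cong (λ r → (toℕ x % 2 + r) % N) (*-comm 2 (toℕ x / 2)) ⟩
    (toℕ x % 2 + toℕ x / 2 * 2) % N     ≡⟨ cong (_% N) (m≡m%n+[m/n]*n (toℕ x) 2) ⟨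
    toℕ x % N                           ≡⟨ m<n⇒m%n≡m x< ⟩
    toℕ x                               ∎)
    where
    open ≡-Reasoning
    2≤N : 2 ≤ N
    2≤N = *-monoʳ-≤ 2 (s≤s z≤n)
    b< : toℕ x % 2 < suc N
    b< = ≤-trans (m%n<n (toℕ x) 2) (≤-trans 2≤N (n≤1+n N))
    b : Fin (suc N)
    b = fromℕ< b<
    b<2 : toℕ b < 2
    b<2 = subst (_< 2) (sym (toℕ-fromℕ< b<)) (m%n<n (toℕ x) 2)

module Relations {c ℓ : Level} (F : Field c ℓ) where
  open Field F
  open Weights F
  open import Algebra.Properties.Group +-group using (∙-cancelʳ)
  open import Algebra.Solver.Ring.NaturalCoefficients.Default commutativeSemiring using (solve; _:+_; _:=_; con)
  open import Relation.Binary.Reasoning.Setoid setoid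

  -- Equal weights of {v₁} ∪ R and {v₀, v₂} ∪ R, R beyond v₂, compare v₁ with v₀, v₂.
  -- (The two sides are the unfolded weights; 0# marks a non-member.)
  cancel₃ : ∀ a b c R → 0# + (b + (0# + R)) ≈ a + (0# + (c + R)) → b ≈ a + c
  cancel₃ a b c R h = ∙-cancelʳ R b (a + c) (begin
    b + R                    ≈⟨ solve 2 (λ b R → b :+ R := con 0 :+ (b :+ (con 0 :+ R))) refl b R ⟩
    0# + (b + (0# + R))      ≈⟨ h ⟩
    a + (0# + (c + R))       ≈⟨ solve 3 (λ a c R → a :+ (con 0 :+ (c :+ R)) := a :+ c :+ R) refl a c R ⟩
    a + c + R                ∎)

  -- the same for {v₁, v₃} ∪ R and {v₀, v₂, v₄} ∪ R
  cancel₅ : ∀ a b c d e R → 0# + (b + (0# + (d + (0# + R)))) ≈ a + (0# + (c + (0# + (e + R)))) →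
            b + d ≈ a + c + e
  cancel₅ a b c d e R h = ∙-cancelʳ R (b + d) (a + c + e) (begin
    b + d + R
      ≈⟨ solve 3 (λ b d R → b :+ d :+ R := con 0 :+ (b :+ (con 0 :+ (d :+ (con 0 :+ R))))) refl b d R ⟩
    0# + (b + (0# + (d + (0# + R))))
      ≈⟨ h ⟩
    a + (0# + (c + (0# + (e + R))))
      ≈⟨ solve 4 (λ a c e R → a :+ (con 0 :+ (c :+ (con 0 :+ (e :+ R)))) := a :+ c :+ e :+ R) refl a c e R ⟩
    a + c + e + R ∎)

  window₁-relation : ∀ m w → WellCovered F (GearAdj (3 Nat.+ m)) w → w (# 1) ≈ w (# 0) + w (# 2)
  window₁-relation m w wc =
    cancel₃ _ _ _ _ (wc _ _ (window-maximal 1 ℕₚ.≤-refl (s≤s (s≤s (s≤s z≤n)))) (evens-maximal (s≤s z≤n)))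
    where open Gear (3 Nat.+ m)

  window₂-relation : ∀ m w → WellCovered F (GearAdj (4 Nat.+ m)) w →
                     w (# 1) + w (# 3) ≈ w (# 0) + w (# 2) + w (# 4)
  window₂-relation m w wc =
    cancel₅ _ _ _ _ _ _ (wc _ _ (window-maximal 2 (s≤s z≤n) (s≤s (s≤s (s≤s (s≤s z≤n))))) (evens-maximal (s≤s z≤n)))
    where open Gear (4 Nat.+ m)

  -- the relations from W 1, W 1 rotated by two steps, and W 2 force w(v₂) = 0
  middle-vanishes : ∀ w₀ w₁ w₂ w₃ w₄ → w₁ ≈ w₀ + w₂ → w₃ ≈ w₂ + w₄ →
                    w₁ + w₃ ≈ w₀ + w₂ + w₄ → w₂ ≈ 0#
  middle-vanishes w₀ w₁ w₂ w₃ w₄ r₁ r₃ r₁₃ = ∙-cancelʳ (w₀ + w₂ + w₄) w₂ 0# (begin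
    w₂ + (w₀ + w₂ + w₄)        ≈⟨ solve 3 (λ a c e → c :+ (a :+ c :+ e) := (a :+ c) :+ (c :+ e)) refl w₀ w₂ w₄ ⟩
    (w₀ + w₂) + (w₂ + w₄)      ≈⟨ +-cong r₁ r₃ ⟨
    w₁ + w₃                    ≈⟨ r₁₃ ⟩
    w₀ + w₂ + w₄               ≈⟨ +-identityˡ _ ⟨
    0# + (w₀ + w₂ + w₄)        ∎)

module Vanishing {c ℓ : Level} (F : Field c ℓ) (m : ℕ) where
  open Field F
  open Weights F
  open Relations F
  open Rotation (3 Nat.+ m)
  open Gear (4 Nat.+ m)
  open import Relation.Binary.Reasoning.Setoid setoid

  Vertex : Set
  Vertex = Fin (suc N)

  WC : (Vertex → Carrier) → Set ℓ
  WC = WellCovered F (GearAdj (4 Nat.+ m))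

  rotate : ∀ a w → WC w → WC (w ∘ ρ a)
  rotate a w = well-covered-∘ (GearAdj (4 Nat.+ m)) (rotation a) w

  below₈ : ∀ i {i<8 : T (i Nat.<ᵇ 8)} → i < N
  below₈ i {i<8} = ℕₚ.≤-trans (ℕₚ.<ᵇ⇒< i 8 i<8) (ℕₚ.*-monoʳ-≤ 2 (ℕₚ.m≤m+n 4 m))

  ρ₁ : ∀ (x y : Vertex) → toℕ x Nat.+ 2 ≡ toℕ y → toℕ y < N → ρ 1 x ≡ y
  ρ₁ x y x+2≡y y<N = toℕ-injective (≡.trans (ρ-shift 1 x (≡.subst (_< N) (≡.sym x+2≡y) y<N)) x+2≡y)

  v₂-vanishes : ∀ w → WC w → w (# 2) ≈ 0#
  v₂-vanishes w wc = middle-vanishes _ _ _ _ _ (window₁-relation (1 Nat.+ m) w wc) shifted (window₂-relation m w wc)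
    where
    shifted : w (# 3) ≈ w (# 2) + w (# 4)
    shifted = begin
      w (# 3)                        ≡⟨ ≡.cong w (ρ₁ (# 1) (# 3) ≡.refl (below₈ 3)) ⟨
      w (ρ 1 (# 1))                  ≈⟨ window₁-relation (1 Nat.+ m) (w ∘ ρ 1) (rotate 1 w wc) ⟩
      w (ρ 1 (# 0)) + w (ρ 1 (# 2))  ≡⟨ ≡.cong₂ (λ x y → w x + w y)
                                                (ρ₁ (# 0) (# 2) ≡.refl (below₈ 2))
                                                (ρ₁ (# 2) (# 4) ≡.refl (below₈ 4)) ⟩
      w (# 2) + w (# 4)              ∎

  -- w(v₀) is w(v₂) for the rotated weighting
  v₀-vanishes : ∀ w → WC w → w (# 0) ≈ 0#
  v₀-vanishes w wc = ≡.subst (λ x → w x ≈ 0#) to-v₀ (v₂-vanishes (w ∘ ρ (3 Nat.+ m)) (rotate (3 Nat.+ m) w wc))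
    where
    to-v₀ : ρ (3 Nat.+ m) (# 2) ≡ # 0
    to-v₀ = toℕ-injective (≡.trans (toℕ-ρ (3 Nat.+ m) (# 2)) (rot-2 (below₈ 2)))

  v₁-vanishes : ∀ w → WC w → w (# 1) ≈ 0#
  v₁-vanishes w wc = begin
    w (# 1)            ≈⟨ window₁-relation (1 Nat.+ m) w wc ⟩
    w (# 0) + w (# 2)  ≈⟨ +-cong (v₀-vanishes w wc) (v₂-vanishes w wc) ⟩
    0# + 0#            ≈⟨ +-identityˡ 0# ⟩
    0#                 ∎

  -- by rotation, every rim vertex behaves like v₀ or v₁
  rim-vanishes : ∀ w → WC w → ∀ x → toℕ x < N → w x ≈ 0#
  rim-vanishes w wc x x<N with orbit x x<N
  ... | a , b , b<2 , ρab≡x = ≡.subst (λ y → w y ≈ 0#) ρab≡x (base b b<2)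
    where
    base : ∀ b → toℕ b < 2 → w (ρ a b) ≈ 0#
    base fzero           _ = v₀-vanishes (w ∘ ρ a) (rotate a w wc)
    base (fsuc fzero)    _ = v₁-vanishes (w ∘ ρ a) (rotate a w wc)
    base (fsuc (fsuc b)) (s≤s (s≤s ()))

  -- comparing C with E, once the rim carries no weight
  centre-vanishes : ∀ w → WC w → w (fromℕ N) ≈ 0#
  centre-vanishes w wc = begin
    w (fromℕ N)                                      ≡⟨⟩
    select true (w (fromℕ N))                        ≡⟨ ≡.cong (λ b → select b (w (fromℕ N))) in-C ⟨
    select (lookup (mask odds+centre) (fromℕ N)) _   ≈⟨ weight-at (mask odds+centre) w (fromℕ N) off-centre ⟨
    weightOf F (mask odds+centre) w                  ≈⟨ wc _ _ odds+centre-maximal (evens-maximal (s≤s z≤n)) ⟩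
    weightOf F (mask evens) w                        ≈⟨ weight-at (mask evens) w (fromℕ N) off-centre ⟩
    select (lookup (mask evens) (fromℕ N)) _         ≡⟨ ≡.cong (λ b → select b (w (fromℕ N))) in-E ⟩
    0#                                               ∎
    where
    off-centre : ∀ y → y ≢ fromℕ N → w y ≈ 0#
    off-centre y y≢c = rim-vanishes w wc y
      (ℕₚ.≤∧≢⇒< (ℕₚ.≤-pred (toℕ<n y)) (λ e → y≢c (toℕ-injective (≡.trans e (≡.sym (toℕ-fromℕ N))))))
    in-C : lookup (mask odds+centre) (fromℕ N) ≡ true
    in-C = ≡.trans (lookup∘tabulate (odds+centre ∘ toℕ) (fromℕ N))
                   (≡.trans (≡.cong (not ∘ evens) (toℕ-fromℕ N)) (≡.cong not evens-centre))
    in-E : lookup (mask evens) (fromℕ N) ≡ false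
    in-E = ≡.trans (lookup∘tabulate (evens ∘ toℕ) (fromℕ N)) (≡.trans (≡.cong evens (toℕ-fromℕ N)) evens-centre)

  vanishes : ∀ w → WC w → ∀ x → w x ≈ 0#
  vanishes w wc x with ℕₚ.m≤n⇒m<n∨m≡n (ℕₚ.≤-pred (toℕ<n x))
  ... | inj₁ x<N = rim-vanishes w wc x x<N
  ... | inj₂ x≡N =
    ≡.subst (λ y → w y ≈ 0#) (≡.sym (toℕ-injective (≡.trans x≡N (≡.sym (toℕ-fromℕ N))))) (centre-vanishes w wc)

  dimension-0 : WcDim F (GearAdj (4 Nat.+ m)) 0
  dimension-0 = (λ ()) , (λ ()) , (λ _ _ ()) , λ w wc → (λ ()) , vanishes w wc

module Three {c ℓ : Level} (F : Field c ℓ) where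
  open Field F
  open Weights F
  open Relations F
  open Rotation 2
  open Gear 3
  open Graphs (GearAdj 3)
  open import Algebra.Definitions.RawMonoid +-rawMonoid using () renaming (_×_ to _·_)
  open import Algebra.Properties.Group +-group using (∙-cancelʳ)
  open import Algebra.Properties.Ring ring using (-‿distribʳ-*)
  open import Algebra.Solver.Ring.NaturalCoefficients.Default commutativeSemiring using (solve; _:+_; _:=_; con)
  open import Relation.Binary.Reasoning.Setoid setoid

  -- b k: coefficient +1 on v_{2k} and its two rim neighbours, -1 at the centre
  coefficient : Fin 3 → Fin 7 → Sign
  coefficient k = lookup (lookup table k)
    where
    table : Vec (Vec Sign 7) 3
    table = (plus   ∷ plus ∷ nought ∷ nought ∷ nought ∷ plus   ∷ minus ∷ [])
          ∷ (nought ∷ plus ∷ plus   ∷ plus   ∷ nought ∷ nought ∷ minus ∷ [])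
          ∷ (nought ∷ nought ∷ nought ∷ plus ∷ plus   ∷ plus   ∷ minus ∷ [])
          ∷ []

  basis : Fin 3 → Fin 7 → Carrier
  basis k = ⟦_⟧ ∘ coefficient k

  candidate : Subset 7 → Bool
  candidate M = ⌊ independent? adjacent? M ⌋ ∧ ⌊ dominating? adjacent? M ⌋

  balanced-for : Fin 3 → Subset 7 → Bool
  balanced-for k M = pluses M (coefficient k) ≡ᵇ suc (minuses M (coefficient k))

  -- exhaustive check over all 2⁷ vertex sets: every candidate is balanced
  balanced : ∀ k → T (everyVec (λ M → if candidate M then balanced-for k M else true))
  balanced fzero               = _
  balanced (fsuc fzero)        = _
  balanced (fsuc (fsuc fzero)) = _

  basis-weight : ∀ k M → MaximalIndependent (GearAdj 3) M → weightOf F M (basis k) ≈ 1#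
  basis-weight k M mis = ∙-cancelʳ (minuses M (coefficient k) · 1#) _ 1#
    (trans (signed-weight M (coefficient k))
      (reflexive (≡.cong (_· 1#) counts)))
    where
    is-candidate : T (candidate M)
    is-candidate = Equivalence.from T-∧ (fromWitness {a? = independent? adjacent? M} (proj₁ mis) ,
                                        fromWitness {a? = dominating? adjacent? M} (maximal⇒dominating loopless adjacent? M mis))
    conclude : ∀ {b P} → T b → T (if b then P else true) → T P
    conclude {true} _ p = p
    counts : pluses M (coefficient k) ≡ suc (minuses M (coefficient k))
    counts = ℕₚ.≡ᵇ⇒≡ _ _ (conclude is-candidate
               (everyVec-sound (λ M → if candidate M then balanced-for k M else true) (balanced k) M))

  scale : Sign → Carrier → Carrier
  scale plus   a = a
  scale nought a = 0#
  scale minus  a = - a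

  scale-⟦⟧ : ∀ a σ → a * ⟦ σ ⟧ ≈ scale σ a
  scale-⟦⟧ a plus   = *-identityʳ a
  scale-⟦⟧ a nought = zeroʳ a
  scale-⟦⟧ a minus  = trans (sym (-‿distribʳ-* a 1#)) (-‿cong (*-identityʳ a))

  combination : ∀ (a : Fin 3 → Carrier) x → Σ F 3 (λ i → a i * basis i x) ≈
    scale (coefficient (# 0) x) (a (# 0)) + (scale (coefficient (# 1) x) (a (# 1)) + (scale (coefficient (# 2) x) (a (# 2)) + 0#))
  combination a x = +-cong (scale-⟦⟧ (a (# 0)) (coefficient (# 0) x))
                   (+-cong (scale-⟦⟧ (a (# 1)) (coefficient (# 1) x)) (+-congʳ (scale-⟦⟧ (a (# 2)) (coefficient (# 2) x))))

  -- evaluating at v₀, v₂, v₄ isolates the three coefficients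
  independent : ∀ (a : Fin 3 → Carrier) → (∀ x → Σ F 3 (λ i → a i * basis i x) ≈ 0#) → ∀ i → a i ≈ 0#
  independent a h fzero               = trans (solve 1 (λ a → a := a :+ (con 0 :+ (con 0 :+ con 0))) refl (a (# 0)))
                                              (trans (sym (combination a (# 0))) (h (# 0)))
  independent a h (fsuc fzero)        = trans (solve 1 (λ a → a := con 0 :+ (a :+ (con 0 :+ con 0))) refl (a (# 1)))
                                              (trans (sym (combination a (# 2))) (h (# 2)))
  independent a h (fsuc (fsuc fzero)) = trans (solve 1 (λ a → a := con 0 :+ (con 0 :+ (a :+ con 0))) refl (a (# 2)))
                                              (trans (sym (combination a (# 4))) (h (# 4)))

  module Spanning (w : Fin 7 → Carrier) (wc : WellCovered F (GearAdj 3) w) where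
    rotate : ∀ a → WellCovered F (GearAdj 3) (w ∘ ρ a)
    rotate a = well-covered-∘ (GearAdj 3) (rotation a) w wc

    r₁ : w (# 1) ≈ w (# 0) + w (# 2)
    r₁ = window₁-relation 0 w wc
    r₃ : w (# 3) ≈ w (# 2) + w (# 4)
    r₃ = window₁-relation 0 (w ∘ ρ 1) (rotate 1)
    r₅ : w (# 5) ≈ w (# 4) + w (# 0)
    r₅ = window₁-relation 0 (w ∘ ρ 2) (rotate 2)

    r₆ : w (# 1) + w (# 3) + w (# 5) + w (# 6) ≈ w (# 0) + w (# 2) + w (# 4)
    r₆ = begin
      w (# 1) + w (# 3) + w (# 5) + w (# 6)
        ≈⟨ solve 4 (λ a b c d → a :+ b :+ c :+ d := con 0 :+ (a :+ (con 0 :+ (b :+ (con 0 :+ (c :+ (d :+ con 0)))))))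
                   refl _ _ _ _ ⟩
      weightOf F (mask odds+centre) w
        ≈⟨ wc _ _ odds+centre-maximal (evens-maximal (s≤s z≤n)) ⟩
      weightOf F (mask evens) w
        ≈⟨ solve 3 (λ a b c → a :+ (con 0 :+ (b :+ (con 0 :+ (c :+ (con 0 :+ (con 0 :+ con 0)))))) := a :+ b :+ c)
                   refl _ _ _ ⟩
      w (# 0) + w (# 2) + w (# 4) ∎

    centre : w (# 6) ≈ - w (# 0) + (- w (# 2) + (- w (# 4) + 0#))
    centre = ∙-cancelʳ s (w (# 6)) _ (trans w₆+s≈0 (sym T+s≈0))
      where
      s : Carrier
      s = w (# 0) + w (# 2) + w (# 4)
      w₆+s≈0 : w (# 6) + s ≈ 0#
      w₆+s≈0 = ∙-cancelʳ s _ 0# (begin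
        w (# 6) + s + s
          ≈⟨ solve 4 (λ a c e g → g :+ (a :+ c :+ e) :+ (a :+ c :+ e) := (a :+ c) :+ (c :+ e) :+ (e :+ a) :+ g)
                     refl (w (# 0)) (w (# 2)) (w (# 4)) (w (# 6)) ⟩
        (w (# 0) + w (# 2)) + (w (# 2) + w (# 4)) + (w (# 4) + w (# 0)) + w (# 6)
          ≈⟨ +-congʳ (+-cong (+-cong r₁ r₃) r₅) ⟨
        w (# 1) + w (# 3) + w (# 5) + w (# 6)
          ≈⟨ r₆ ⟩
        s
          ≈⟨ +-identityˡ s ⟨
        0# + s ∎)
      T+s≈0 : (- w (# 0) + (- w (# 2) + (- w (# 4) + 0#))) + s ≈ 0#
      T+s≈0 = begin
        (- w (# 0) + (- w (# 2) + (- w (# 4) + 0#))) + s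
          ≈⟨ solve 6 (λ a a′ c c′ e e′ → (a′ :+ (c′ :+ (e′ :+ con 0))) :+ (a :+ c :+ e)
                                        := (a′ :+ a) :+ ((c′ :+ c) :+ (e′ :+ e))) refl
                     (w (# 0)) (- w (# 0)) (w (# 2)) (- w (# 2)) (w (# 4)) (- w (# 4)) ⟩
        (- w (# 0) + w (# 0)) + ((- w (# 2) + w (# 2)) + (- w (# 4) + w (# 4)))
          ≈⟨ +-cong (-‿inverseˡ _) (+-cong (-‿inverseˡ _) (-‿inverseˡ _)) ⟩
        0# + (0# + 0#)
          ≈⟨ trans (+-identityˡ _) (+-identityˡ _) ⟩
        0# ∎

    coefficients : Fin 3 → Carrier
    coefficients = w ∘ lookup (# 0 ∷ # 2 ∷ # 4 ∷ [])

    spans : ∀ x → w x ≈ Σ F 3 (λ i → coefficients i * basis i x)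
    spans x = trans (explicit x) (sym (combination coefficients x))
      where
      explicit : ∀ x → w x ≈ scale (coefficient (# 0) x) (w (# 0))
                             + (scale (coefficient (# 1) x) (w (# 2)) + (scale (coefficient (# 2) x) (w (# 4)) + 0#))
      explicit fzero = solve 1 (λ a → a := a :+ (con 0 :+ (con 0 :+ con 0))) refl _
      explicit (fsuc fzero) = trans r₁ (solve 2 (λ a c → a :+ c := a :+ (c :+ (con 0 :+ con 0))) refl _ _)
      explicit (fsuc (fsuc fzero)) = solve 1 (λ c → c := con 0 :+ (c :+ (con 0 :+ con 0))) refl _
      explicit (fsuc (fsuc (fsuc fzero))) = trans r₃ (solve 2 (λ c e → c :+ e := con 0 :+ (c :+ (e :+ con 0))) refl _ _)
      explicit (fsuc (fsuc (fsuc (fsuc fzero)))) = solve 1 (λ e → e := con 0 :+ (con 0 :+ (e :+ con 0))) refl _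
      explicit (fsuc (fsuc (fsuc (fsuc (fsuc fzero))))) = trans r₅ (solve 2 (λ e a → e :+ a := a :+ (con 0 :+ (e :+ con 0))) refl _ _)
      explicit (fsuc (fsuc (fsuc (fsuc (fsuc (fsuc fzero)))))) = centre

  dimension-3 : WcDim F (GearAdj 3) 3
  dimension-3 = basis , (λ k M M′ mis mis′ → trans (basis-weight k M mis) (sym (basis-weight k M′ mis′))) ,
                independent , λ w wc → Spanning.coefficients w wc , Spanning.spans w wc

mainTheorem5 : ∀ {c ℓ : Level} (n : ℕ) → 3 ≤ n → (F : Field c ℓ) →
    (n ≡ 3 → WcDim F (GearAdj n) 3) × (3 < n → WcDim F (GearAdj n) 0)
mainTheorem5 n _ F = (λ { ≡.refl → Three.dimension-3 F }) , large n
  where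
  large : ∀ n → 3 < n → WcDim F (GearAdj n) 0
  large _ (s≤s (s≤s (s≤s (s≤s {n = m} _)))) = Vanishing.dimension-0 F m
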